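{- Let $\Omega=(V,E)$ be a non-bipartite connected simple graph (no loops, no multiple edges) with vertex set $V=\{v_1,\dots,v_n\}$ and edge set $E=\{e_1,\dots,e_m\}$, where $m\geq n$. Let $W=BD^{ -1}\in\mathbb{R}^{m\times n}$ be its weighted signless edge-vertex incidence matrix. Then $$\mu_{\infty}(\Omega)=\min_{\|X\|_{\infty}=1}\|WX\|_{\infty}=\frac{1}{\min\limits_{WGW=W}\|G\|_{\infty,\infty}},$$ where the minimum in the denominator is over all real $n\times m$ matrices $G$ with $WGW=W$.
   Context: The edge-vertex incidence matrix $B=(b_{ij})\in\mathbb{R}^{m\times n}$ has $b_{ij}=1$ if $v_j$ is incident to $e_i$ and $b_{ij}=0$ otherwise. $D=\mathrm{diag}(d_1,\dots,d_n)$ where $d_i$ is the degree of $v_i$. The smallest normalized signless $\infty$-Laplacian eigenvalue is $\mu_\infty(\Omega)=\min_{\|X\|_\infty=1}\|WX\|_\infty=\min_{\|X\|_\infty=1}\max_{v_i\sim v_j}\left|\frac{x_i}{d_i}+\frac{x_j}{d_j}\right|$ for $X=(x_1,\dots,x_n)^{\mathrm T}\in\mathbb{R}^n$. For $x\in\mathbb{R}^n$, $\|x\|_\infty=\max_i|x_i|$, and for a real matrix $A=(a_{ij})$ with $m$ rows, $\|A\|_{\infty,\infty}=\max\{\|AX\|_\infty:\|X\|_\infty=1\}=\max_i\sum_j|a_{ij}|$. A real $n\times m$ matrix $G$ is a generalized inverse of $W$ if $WGW=W$.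
   Formalization: The vectors X and the generalized inverses G over which both minima are taken have rational entries rather than real ones. -}

module Defs where

open import Data.Nat as ℕ using (ℕ; zero; suc)
open import Data.Integer using (+_)
open import Data.Rational using (ℚ; 0ℚ; 1ℚ; _+_; _*_; _⊔_; ∣_∣; _≤_; _/_)
open import Data.Fin using (Fin)
open import Data.Fin.Properties using (_≟_)
open import Data.List using (List; foldr; allFin)
open import Data.Bool using (Bool; true; false; if_then_else_)
open import Data.Product using (Σ; _×_; _,_; proj₁; proj₂; ∃)
open import Data.Sum using (_⊎_)
open import Relation.Binary.PropositionalEquality using (_≡_; _≢_)
open import Relation.Nullary.Decidable using (⌊_⌋)

-- A graph on vertex set Fin n with edge list e : Fin m → Fin n × Fin n
-- (edge e_i joins proj₁ (e i) and proj₂ (e i)).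
Edges : ℕ → ℕ → Set
Edges m n = Fin m → Fin n × Fin n

Loopless : ∀ {m n} → Edges m n → Set
Loopless e = ∀ i → proj₁ (e i) ≢ proj₂ (e i)

NoMultiEdges : ∀ {m n} → Edges m n → Set
NoMultiEdges e = ∀ i j →
  ((proj₁ (e i) ≡ proj₁ (e j) × proj₂ (e i) ≡ proj₂ (e j))
   ⊎ (proj₁ (e i) ≡ proj₂ (e j) × proj₂ (e i) ≡ proj₁ (e j))) → i ≡ j

Simple : ∀ {m n} → Edges m n → Set
Simple e = Loopless e × NoMultiEdges e

Adjacent : ∀ {m n} → Edges m n → Fin n → Fin n → Set
Adjacent e u v = ∃ λ i → (proj₁ (e i) ≡ u × proj₂ (e i) ≡ v) ⊎ (proj₁ (e i) ≡ v × proj₂ (e i) ≡ u)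

data Reachable {m n} (e : Edges m n) : Fin n → Fin n → Set where
  here : ∀ {u} → Reachable e u u
  step : ∀ {u v w} → Adjacent e u v → Reachable e v w → Reachable e u w

Connected : ∀ {m n} → Edges m n → Set
Connected e = ∀ u v → Reachable e u v

Bipartite : ∀ {m n} → Edges m n → Set
Bipartite e = Σ (_ → Bool) λ c → ∀ i → c (proj₁ (e i)) ≢ c (proj₂ (e i))

incident : ∀ {m n} → Edges m n → Fin m → Fin n → Bool
incident e i j = ⌊ proj₁ (e i) ≟ j ⌋ Data.Bool.∨ ⌊ proj₂ (e i) ≟ j ⌋
  where import Data.Bool

count : ∀ {k} → (Fin k → Bool) → ℕ
count {k} p = foldr (λ i acc → if p i then suc acc else acc) 0 (allFin k)

degree : ∀ {m n} → Edges m n → Fin n → ℕ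
degree {m} e j = count (λ i → incident e i j)

-- 1/d as a rational (only ever used for d ≥ 1)
inv : ℕ → ℚ
inv zero = 0ℚ
inv (suc k) = (+ 1) / suc k

sumF : ∀ {k} → (Fin k → ℚ) → ℚ
sumF {k} f = foldr (λ i acc → f i + acc) 0ℚ (allFin k)

maxF : ∀ {k} → (Fin k → ℚ) → ℚ
maxF {k} f = foldr (λ i acc → f i ⊔ acc) 0ℚ (allFin k)

Matrix : ℕ → ℕ → Set
Matrix r c = Fin r → Fin c → ℚ

incMatrix : ∀ {m n} → Edges m n → Matrix m n
incMatrix e i j = if incident e i j then 1ℚ else 0ℚ

W : ∀ {m n} → Edges m n → Matrix m n
W e i j = incMatrix e i j * inv (degree e j)

_·_ : ∀ {r k c} → Matrix r k → Matrix k c → Matrix r c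
(A · B) i j = sumF (λ l → A i l * B l j)

_·v_ : ∀ {r c} → Matrix r c → (Fin c → ℚ) → (Fin r → ℚ)
(A ·v x) i = sumF (λ l → A i l * x l)

‖_‖∞ : ∀ {k} → (Fin k → ℚ) → ℚ
‖ x ‖∞ = maxF (λ i → ∣ x i ∣)

‖_‖∞∞ : ∀ {r c} → Matrix r c → ℚ
‖ A ‖∞∞ = maxF (λ i → sumF (λ j → ∣ A i j ∣))

edgeObjective : ∀ {m n} → Edges m n → (Fin n → ℚ) → ℚ
edgeObjective e x = maxF (λ i →
  ∣ x (proj₁ (e i)) * inv (degree e (proj₁ (e i)))
    + x (proj₂ (e i)) * inv (degree e (proj₂ (e i))) ∣)

IsMinimum : {A : Set} → (A → Set) → (A → ℚ) → ℚ → Set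
IsMinimum P f v = (Σ _ λ a → P a × f a ≡ v) × (∀ a → P a → v ≤ f a)

GenInverse : ∀ {m n} → Matrix m n → Matrix n m → Set
GenInverse A G = ∀ i j → ((A · G) · A) i j ≡ A i j

-- Put y = D⁻¹X, so that (WX)_e = y_u + y_v on an edge e = uv and ‖WX‖∞ is the edge objective E(X).
-- Along a walk of length t from u to v, |y_u - (-1)^t y_v| ≤ t E(X); going around a shortest odd
-- closed walk through k, of length ℓ_k, gives |X_k| ≤ κ_k E(X) with κ_k = d_k ℓ_k / 2.  Hence
-- μ = 1/κ, κ = max_k κ_k, bounds E from below on the unit sphere, and W is injective.  The bound
-- is attained by X_v = d_v (b_v - a_v) μ / 2, where a_v and b_v are the lengths of shortest even
-- and odd walks to v from a vertex k maximising κ_k: an edge uv gives b_v ≤ a_u + 1 and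
-- a_v ≤ b_u + 1, while a_k = 0 and b_k = ℓ_k make X_k = 1.  Dually, the edge vector of the
-- shortest odd closed walk at k with alternating signs ±d_k/2 is row k of a left inverse G of W
-- with ‖G‖ ≤ κ; and since W is injective, every generalized inverse G satisfies GWX = X, whence
-- 1 = ‖X‖ ≤ ‖G‖ ‖WX‖ = ‖G‖ μ at the extremal X.
{-# OPTIONS --safe #-}
module Submission where

open import Defs
open import Algebra.Bundles using (Ring)
open import Data.Bool using (Bool; true; false; if_then_else_)
open import Data.Fin using (Fin; zero; suc)
open import Data.Fin.Properties using (_≟_; any?; ¬Fin0)
open import Data.List using (foldr; allFin)
open import Data.List.Properties using (map-tabulate; foldr-map)
open import Data.Nat as ℕ using (ℕ; zero; suc; _≥_)
open import Data.Nat.Base using (parity)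
open import Data.Nat.Induction using (<-rec)
import Data.Nat.Properties as ℕP
open import Data.Parity as ℙ using (Parity; 0ℙ; 1ℙ; _⁻¹)
import Data.Parity.Properties as ℙP
open import Data.Product using (Σ; _×_; _,_; proj₁; proj₂; ∃)
open import Data.Rational as ℚ using (ℚ; 0ℚ; 1ℚ; ½; _+_; _*_; -_; _-_; ∣_∣; _≤_; _<_; _⊔_)
import Data.Rational.Properties as ℚP
open import Data.Rational.Solver using (module +-*-Solver)
open import Data.Sum using (_⊎_; inj₁; inj₂)
open import Function using (_∘_; id)
open import Relation.Binary.PropositionalEquality
open import Relation.Nullary using (¬_; Dec; yes; no; does; contradiction)
open import Relation.Nullary.Decidable using (_×-dec_; _⊎-dec_)

open import Algebra.Properties.Group ℚP.+-0-group using (x∙y⁻¹≈ε⇒x≈y)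
open import Algebra.Properties.Semiring.Sum (Ring.semiring ℚP.+-*-ring)
  using (sum; sum-cong-≗; ∑-distrib-+; ∑-comm; *-distribˡ-sum; *-distribʳ-sum)
open +-*-Solver using (solve; _:+_; _:*_; :-_; _:-_; _:=_; con)

*-monoˡ-≤-0≤ : ∀ {r p q} → 0ℚ ≤ r → p ≤ q → r * p ≤ r * q
*-monoˡ-≤-0≤ {r} 0≤r = ℚP.*-monoˡ-≤-nonNeg r {{ℚ.nonNegative 0≤r}}

*-monoʳ-≤-0≤ : ∀ {r p q} → 0ℚ ≤ r → p ≤ q → p * r ≤ q * r
*-monoʳ-≤-0≤ {r} 0≤r = ℚP.*-monoʳ-≤-nonNeg r {{ℚ.nonNegative 0≤r}}

0≤p*q : ∀ {p q} → 0ℚ ≤ p → 0ℚ ≤ q → 0ℚ ≤ p * q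
0≤p*q {p} {q} 0≤p 0≤q = subst (_≤ p * q) (ℚP.*-zeroʳ p) (*-monoˡ-≤-0≤ 0≤p 0≤q)

0<p*q : ∀ {p q} → 0ℚ < p → 0ℚ < q → 0ℚ < p * q
0<p*q {p} {q} 0<p 0<q =
  ℚP.positive⁻¹ (p * q) {{ℚP.pos*pos⇒pos p {{ℚ.positive 0<p}} q {{ℚ.positive 0<q}}}}

∣p∣≤q : ∀ {p q} → p ≤ q → - p ≤ q → ∣ p ∣ ≤ q
∣p∣≤q {p} p≤q -p≤q with ℚP.∣p∣≡p∨∣p∣≡-p p
... | inj₁ ∣p∣≡p  = subst (_≤ _) (sym ∣p∣≡p) p≤q
... | inj₂ ∣p∣≡-p = subst (_≤ _) (sym ∣p∣≡-p) -p≤q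

∣p-q∣≤1 : ∀ {p q} → p ≤ q + 1ℚ → q ≤ p + 1ℚ → ∣ p - q ∣ ≤ 1ℚ
∣p-q∣≤1 {p} {q} p≤q+1 q≤p+1 = ∣p∣≤q (p-q≤1 p≤q+1) (subst (_≤ 1ℚ) (swap q p) (p-q≤1 q≤p+1))
  where
  p-q≤1 : ∀ {a b} → a ≤ b + 1ℚ → a - b ≤ 1ℚ
  p-q≤1 {a} {b} a≤b+1 =
    subst (a - b ≤_) (solve 1 (λ b → b :+ con 1ℚ :- b := con 1ℚ) refl b) (ℚP.+-monoˡ-≤ (- b) a≤b+1)
  swap : ∀ a b → a - b ≡ - (b - a)
  swap = solve 2 (λ a b → a :- b := :- (b :- a)) refl

∣p*q∣≡p*∣q∣ : ∀ {p} q → 0ℚ ≤ p → ∣ p * q ∣ ≡ p * ∣ q ∣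
∣p*q∣≡p*∣q∣ {p} q 0≤p = trans (ℚP.∣p*q∣≡∣p∣*∣q∣ p q) (cong (_* ∣ q ∣) (ℚP.0≤p⇒∣p∣≡p 0≤p))

-- The degree d as a rational, written 1/(1/d) so that d * inv d ≡ 1 is the library's *-inverseˡ.
inv⁻¹ : ℕ → ℚ
inv⁻¹ zero    = 0ℚ
inv⁻¹ (suc d) = (ℚ.1/ inv (suc d)) {{ℚP.pos⇒nonZero (inv (suc d)) {{ℚP.normalize-pos 1 (suc d)}}}}

inv⁻¹*inv≡1 : ∀ {d c} → d ≡ suc c → inv⁻¹ d * inv d ≡ 1ℚ
inv⁻¹*inv≡1 {c = c} refl =
  ℚP.*-inverseˡ (inv (suc c)) {{ℚP.pos⇒nonZero (inv (suc c)) {{ℚP.normalize-pos 1 (suc c)}}}}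

0<inv⁻¹ : ∀ {d c} → d ≡ suc c → 0ℚ < inv⁻¹ d
0<inv⁻¹ {c = c} refl = ℚP.positive⁻¹ _ {{ℚP.1/pos⇒pos (inv (suc c)) {{ℚP.normalize-pos 1 (suc c)}}}}

foldr-allFin-suc : ∀ {A : Set} {k} (c : Fin (suc k) → A → A) (z : A) →
  foldr c z (allFin (suc k)) ≡ c zero (foldr (c ∘ suc) z (allFin k))
foldr-allFin-suc {k = k} c z =
  cong (c zero) (trans (cong (foldr c z) (sym (map-tabulate id suc))) (foldr-map c suc z (allFin k)))

sumF≡sum : ∀ {k} (f : Fin k → ℚ) → sumF f ≡ sum f
sumF≡sum {zero}  f = refl
sumF≡sum {suc k} f =
  trans (foldr-allFin-suc (λ i acc → f i + acc) 0ℚ) (cong (f zero +_) (sumF≡sum (f ∘ suc)))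

sumF-cong : ∀ {k} {f g : Fin k → ℚ} → (∀ i → f i ≡ g i) → sumF f ≡ sumF g
sumF-cong {f = f} {g} f≗g = trans (sumF≡sum f) (trans (sum-cong-≗ f≗g) (sym (sumF≡sum g)))

sum-mono-≤ : ∀ {k} {f g : Fin k → ℚ} → (∀ i → f i ≤ g i) → sum f ≤ sum g
sum-mono-≤ {zero}  f≤g = ℚP.≤-refl
sum-mono-≤ {suc k} f≤g = ℚP.+-mono-≤ (f≤g zero) (sum-mono-≤ (f≤g ∘ suc))

∣sum∣≤sum∣∣ : ∀ {k} (f : Fin k → ℚ) → ∣ sum f ∣ ≤ sum (∣_∣ ∘ f)
∣sum∣≤sum∣∣ {zero}  f = ℚP.≤-refl
∣sum∣≤sum∣∣ {suc k} f = ℚP.≤-trans (ℚP.∣p+q∣≤∣p∣+∣q∣ (f zero) (sum (f ∘ suc)))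
  (ℚP.+-monoʳ-≤ ∣ f zero ∣ (∣sum∣≤sum∣∣ (f ∘ suc)))

sum-0* : ∀ {k} (f : Fin k → ℚ) → sum (λ l → 0ℚ * f l) ≡ 0ℚ
sum-0* f = trans (sym (*-distribˡ-sum 0ℚ f)) (ℚP.*-zeroˡ (sum f))

δ : ∀ {k} → Fin k → Fin k → ℚ
δ i j = if does (i ≟ j) then 1ℚ else 0ℚ

δ-sym : ∀ {k} (i j : Fin k) → δ i j ≡ δ j i
δ-sym i j with i ≟ j | j ≟ i
... | yes _   | yes _   = refl
... | no  _   | no  _   = refl
... | yes i≡j | no  j≢i = contradiction (sym i≡j) j≢i
... | no  i≢j | yes j≡i = contradiction (sym j≡i) i≢j

δ*1≡∣δ∣ : ∀ {k} (i j : Fin k) → δ i j * 1ℚ ≡ ∣ δ i j ∣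
δ*1≡∣δ∣ i j with i ≟ j
... | yes _ = refl
... | no  _ = refl

δ-diag : ∀ {k} (f : Fin k → ℚ) (i j : Fin k) → f j * δ i j ≡ f i * δ i j
δ-diag f i j with i ≟ j
... | yes refl = refl
... | no  _    = trans (ℚP.*-zeroʳ (f j)) (sym (ℚP.*-zeroʳ (f i)))

sum-δ : ∀ {k} (i : Fin k) (f : Fin k → ℚ) → sum (λ l → δ i l * f l) ≡ f i
sum-δ {suc k} zero f = begin
  1ℚ * f zero + sum (λ l → 0ℚ * f (suc l))  ≡⟨ cong₂ _+_ (ℚP.*-identityˡ (f zero)) (sum-0* (f ∘ suc)) ⟩
  f zero + 0ℚ                              ≡⟨ ℚP.+-identityʳ (f zero) ⟩
  f zero                                   ∎
  where open ≡-Reasoning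
sum-δ {suc k} (suc i) f = begin
  0ℚ * f zero + sum (λ l → δ i l * f (suc l))  ≡⟨ cong (_+ sum (λ l → δ i l * f (suc l))) (ℚP.*-zeroˡ (f zero)) ⟩
  0ℚ + sum (λ l → δ i l * f (suc l))           ≡⟨ ℚP.+-identityˡ (sum (λ l → δ i l * f (suc l))) ⟩
  sum (λ l → δ i l * f (suc l))                ≡⟨ sum-δ i (f ∘ suc) ⟩
  f (suc i)                                    ∎
  where open ≡-Reasoning

sum-δʳ : ∀ {k} (j : Fin k) (f : Fin k → ℚ) → sum (λ l → f l * δ l j) ≡ f j
sum-δʳ j f =
  trans (sum-cong-≗ (λ l → trans (ℚP.*-comm (f l) (δ l j)) (cong (_* f l) (δ-sym l j)))) (sum-δ j f)

maxF-suc : ∀ {k} (f : Fin (suc k) → ℚ) → maxF f ≡ f zero ⊔ maxF (f ∘ suc)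
maxF-suc f = foldr-allFin-suc (λ i acc → f i ⊔ acc) 0ℚ

maxF-cong : ∀ {k} {f g : Fin k → ℚ} → (∀ i → f i ≡ g i) → maxF f ≡ maxF g
maxF-cong {zero}          f≗g = refl
maxF-cong {suc k} {f} {g} f≗g =
  trans (maxF-suc f) (trans (cong₂ _⊔_ (f≗g zero) (maxF-cong (f≗g ∘ suc))) (sym (maxF-suc g)))

0≤maxF : ∀ {k} (f : Fin k → ℚ) → 0ℚ ≤ maxF f
0≤maxF {zero}  f = ℚP.≤-refl
0≤maxF {suc k} f = subst (0ℚ ≤_) (sym (maxF-suc f)) (ℚP.p≤q⇒p≤r⊔q (f zero) (0≤maxF (f ∘ suc)))

≤-maxF : ∀ {k} (f : Fin k → ℚ) (i : Fin k) → f i ≤ maxF f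
≤-maxF {suc k} f zero    = subst (f zero ≤_) (sym (maxF-suc f)) (ℚP.p≤p⊔q _ _)
≤-maxF {suc k} f (suc i) =
  subst (f (suc i) ≤_) (sym (maxF-suc f)) (ℚP.p≤q⇒p≤r⊔q (f zero) (≤-maxF (f ∘ suc) i))

maxF-lub : ∀ {k} (f : Fin k → ℚ) {c : ℚ} → 0ℚ ≤ c → (∀ i → f i ≤ c) → maxF f ≤ c
maxF-lub {zero}  f 0≤c f≤c = 0≤c
maxF-lub {suc k} f 0≤c f≤c =
  subst (_≤ _) (sym (maxF-suc f)) (ℚP.⊔-lub (f≤c zero) (maxF-lub (f ∘ suc) 0≤c (f≤c ∘ suc)))

maxF-attained : ∀ {k} (f : Fin k → ℚ) {c : ℚ} (i : Fin k) →
  0ℚ ≤ c → (∀ j → f j ≤ c) → f i ≡ c → maxF f ≡ c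
maxF-attained f i 0≤c f≤c fi≡c =
  ℚP.≤-antisym (maxF-lub f 0≤c f≤c) (subst (_≤ maxF f) fi≡c (≤-maxF f i))

argmax : ∀ {k} → Fin k → (f : Fin k → ℚ) → Σ (Fin k) λ i → ∀ j → f j ≤ f i
argmax {suc zero}    _ f = zero , λ { zero → ℚP.≤-refl }
argmax {suc (suc k)} _ f with argmax zero (f ∘ suc)
... | i , fi-max with ℚP.≤-total (f zero) (f (suc i))
...   | inj₁ f0≤fi = suc i , λ { zero → f0≤fi ; (suc j) → fi-max j }
...   | inj₂ fi≤f0 = zero  , λ { zero → ℚP.≤-refl ; (suc j) → ℚP.≤-trans (fi-max j) fi≤f0 }

IsMinimum-cong : ∀ {A : Set} {P : A → Set} {f g : A → ℚ} {v} →
  (∀ a → f a ≡ g a) → IsMinimum P f v → IsMinimum P g v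
IsMinimum-cong f≗g ((a , Pa , fa≡v) , v≤f) =
  (a , Pa , trans (sym (f≗g a)) fa≡v) , λ a′ Pa′ → subst (_ ≤_) (f≗g a′) (v≤f a′ Pa′)

count-suc : ∀ {k} (f : Fin (suc k) → Bool) →
  count f ≡ (if f zero then suc (count (f ∘ suc)) else count (f ∘ suc))
count-suc f = foldr-allFin-suc (λ i acc → if f i then suc acc else acc) 0

count≡suc : ∀ {k} (f : Fin k → Bool) (i : Fin k) → f i ≡ true → ∃ λ c → count f ≡ suc c
count≡suc {suc k} f zero fi≡true rewrite count-suc f | fi≡true = _ , refl
count≡suc {suc k} f (suc i) fi≡true rewrite count-suc f with f zero
... | true  = _ , refl
... | false = count≡suc (f ∘ suc) i fi≡true

-- Matrices and generalized inverses

module _ {r c : ℕ} where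

  ·v≡sum : (A : Matrix r c) (x : Fin c → ℚ) (i : Fin r) → (A ·v x) i ≡ sum (λ l → A i l * x l)
  ·v≡sum A x i = sumF≡sum (λ l → A i l * x l)

  0≤‖‖∞∞ : (A : Matrix r c) → 0ℚ ≤ ‖ A ‖∞∞
  0≤‖‖∞∞ A = 0≤maxF (λ i → sumF (λ j → ∣ A i j ∣))

  row≤‖‖∞∞ : (A : Matrix r c) (i : Fin r) → sum (λ j → ∣ A i j ∣) ≤ ‖ A ‖∞∞
  row≤‖‖∞∞ A i = subst (_≤ ‖ A ‖∞∞) (sumF≡sum (λ j → ∣ A i j ∣)) (≤-maxF (λ i → sumF (λ j → ∣ A i j ∣)) i)

  ‖Ax‖∞≤‖A‖∞∞*‖x‖∞ : (A : Matrix r c) (x : Fin c → ℚ) → ‖ A ·v x ‖∞ ≤ ‖ A ‖∞∞ * ‖ x ‖∞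
  ‖Ax‖∞≤‖A‖∞∞*‖x‖∞ A x = maxF-lub (λ i → ∣ (A ·v x) i ∣) (0≤p*q (0≤‖‖∞∞ A) (0≤maxF ∣x∣)) λ i → begin
    ∣ (A ·v x) i ∣                  ≡⟨ cong ∣_∣ (·v≡sum A x i) ⟩
    ∣ sum (λ l → A i l * x l) ∣     ≤⟨ ∣sum∣≤sum∣∣ (λ l → A i l * x l) ⟩
    sum (λ l → ∣ A i l * x l ∣)     ≤⟨ sum-mono-≤ (entry≤ i) ⟩
    sum (λ l → ∣ A i l ∣ * ‖ x ‖∞)  ≡⟨ sym (*-distribʳ-sum ‖ x ‖∞ (λ l → ∣ A i l ∣)) ⟩
    sum (λ l → ∣ A i l ∣) * ‖ x ‖∞  ≤⟨ *-monoʳ-≤-0≤ (0≤maxF ∣x∣) (row≤‖‖∞∞ A i) ⟩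
    ‖ A ‖∞∞ * ‖ x ‖∞                ∎
    where
    open ℚP.≤-Reasoning
    ∣x∣ : Fin c → ℚ
    ∣x∣ l = ∣ x l ∣
    entry≤ : ∀ i l → ∣ A i l * x l ∣ ≤ ∣ A i l ∣ * ‖ x ‖∞
    entry≤ i l = subst (_≤ ∣ A i l ∣ * ‖ x ‖∞) (sym (ℚP.∣p*q∣≡∣p∣*∣q∣ (A i l) (x l)))
      (*-monoˡ-≤-0≤ (ℚP.0≤∣p∣ (A i l)) (≤-maxF ∣x∣ l))

·-·v-assoc : ∀ {r k c} (A : Matrix r k) (B : Matrix k c) (x : Fin c → ℚ) (i : Fin r) →
  ((A · B) ·v x) i ≡ (A ·v (B ·v x)) i
·-·v-assoc A B x i = begin
  ((A · B) ·v x) i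
    ≡⟨ ·v≡sum (A · B) x i ⟩
  sum (λ l → (A · B) i l * x l)
    ≡⟨ sum-cong-≗ (λ l → trans (cong (_* x l) (·v≡sum A (λ s → B s l) i))
                                (*-distribʳ-sum (x l) (λ s → A i s * B s l))) ⟩
  sum (λ l → sum (λ s → A i s * B s l * x l))
    ≡⟨ ∑-comm (λ l s → A i s * B s l * x l) ⟩
  sum (λ s → sum (λ l → A i s * B s l * x l))
    ≡⟨ sum-cong-≗ (λ s → trans (sum-cong-≗ (λ l → ℚP.*-assoc (A i s) (B s l) (x l)))
                                (sym (*-distribˡ-sum (A i s) (λ l → B s l * x l)))) ⟩
  sum (λ s → A i s * sum (λ l → B s l * x l))
    ≡⟨ sym (trans (·v≡sum A (B ·v x) i) (sum-cong-≗ (λ s → cong (A i s *_) (·v≡sum B x s)))) ⟩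
  (A ·v (B ·v x)) i ∎
  where open ≡-Reasoning

Injective : ∀ {r c} → Matrix r c → Set
Injective A = ∀ x y → (∀ i → (A ·v x) i ≡ (A ·v y) i) → ∀ k → x k ≡ y k

module _ {m n : ℕ} (A : Matrix m n) (G : Matrix n m) where

  leftInverse⇒genInverse : (∀ k j → (G · A) k j ≡ δ k j) → GenInverse A G
  leftInverse⇒genInverse GA≡I i j = begin
    ((A · G) ·v (λ l → A l j)) i     ≡⟨ ·-·v-assoc A G (λ l → A l j) i ⟩
    (A ·v (λ s → (G · A) s j)) i     ≡⟨ ·v≡sum A (λ s → (G · A) s j) i ⟩
    sum (λ s → A i s * (G · A) s j)  ≡⟨ sum-cong-≗ (λ s → cong (A i s *_) (GA≡I s j)) ⟩
    sum (λ s → A i s * δ s j)        ≡⟨ sum-δʳ j (A i) ⟩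
    A i j                            ∎
    where open ≡-Reasoning

  GAx≡x : GenInverse A G → Injective A → ∀ x k → (G ·v (A ·v x)) k ≡ x k
  GAx≡x AGA≡A injective x = injective (G ·v (A ·v x)) x AGAx≡Ax
    where
    AGAx≡Ax : ∀ i → (A ·v (G ·v (A ·v x))) i ≡ (A ·v x) i
    AGAx≡Ax i = begin
      (A ·v (G ·v (A ·v x))) i  ≡⟨ sym (·-·v-assoc A G (A ·v x) i) ⟩
      ((A · G) ·v (A ·v x)) i   ≡⟨ sym (·-·v-assoc (A · G) A x i) ⟩
      (((A · G) · A) ·v x) i    ≡⟨ sumF-cong (λ l → cong (_* x l) (AGA≡A i l)) ⟩
      (A ·v x) i                ∎
      where open ≡-Reasoning

  ‖x‖∞≤‖G‖∞∞*‖Ax‖∞ : GenInverse A G → Injective A → ∀ x → ‖ x ‖∞ ≤ ‖ G ‖∞∞ * ‖ A ·v x ‖∞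
  ‖x‖∞≤‖G‖∞∞*‖Ax‖∞ AGA≡A injective x =
    maxF-lub (λ k → ∣ x k ∣) (0≤p*q (0≤‖‖∞∞ G) (0≤maxF (λ i → ∣ (A ·v x) i ∣))) λ k →
      subst (λ z → ∣ z ∣ ≤ ‖ G ‖∞∞ * ‖ A ·v x ‖∞) (GAx≡x AGA≡A injective x k)
        (ℚP.≤-trans (≤-maxF (λ k → ∣ (G ·v (A ·v x)) k ∣) k) (‖Ax‖∞≤‖A‖∞∞*‖x‖∞ G (A ·v x)))

fromℕ : ℕ → ℚ
fromℕ zero    = 0ℚ
fromℕ (suc t) = fromℕ t + 1ℚ

0≤fromℕ : ∀ t → 0ℚ ≤ fromℕ t
0≤fromℕ zero    = ℚP.≤-refl
0≤fromℕ (suc t) = ℚP.+-mono-≤ (0≤fromℕ t) (ℚP.<⇒≤ (ℚP.positive⁻¹ 1ℚ))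

0<fromℕ-suc : ∀ t → 0ℚ < fromℕ (suc t)
0<fromℕ-suc t = ℚP.<-≤-trans (ℚP.positive⁻¹ 1ℚ)
  (subst (_≤ fromℕ t + 1ℚ) (ℚP.+-identityˡ 1ℚ) (ℚP.+-monoˡ-≤ 1ℚ (0≤fromℕ t)))

fromℕ-mono-≤ : ∀ {s t} → s ℕ.≤ t → fromℕ s ≤ fromℕ t
fromℕ-mono-≤ {t = t} ℕ.z≤n = 0≤fromℕ t
fromℕ-mono-≤ (ℕ.s≤s s≤t)   = ℚP.+-monoˡ-≤ 1ℚ (fromℕ-mono-≤ s≤t)

parity-suc : ∀ t → parity (suc t) ≡ parity t ⁻¹
parity-suc t = trans (sym (ℙP.⁻¹-involutive (parity (suc t)))) (cong _⁻¹ (ℙP.suc-homo-⁻¹ t))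

odd⇒suc : ∀ t → parity t ≡ 1ℙ → ∃ λ s → t ≡ suc s
odd⇒suc (suc s) _ = s , refl

+⁻¹≡⁻¹ : ∀ π ρ → π ℙ.+ ρ ⁻¹ ≡ (π ℙ.+ ρ) ⁻¹
+⁻¹≡⁻¹ 0ℙ ρ = refl
+⁻¹≡⁻¹ 1ℙ ρ = refl

≢⇒⁻¹≡ : ∀ {π ρ} → π ≢ ρ → π ⁻¹ ≡ ρ
≢⇒⁻¹≡ {0ℙ} {0ℙ} π≢ρ = contradiction refl π≢ρ
≢⇒⁻¹≡ {0ℙ} {1ℙ} π≢ρ = refl
≢⇒⁻¹≡ {1ℙ} {0ℙ} π≢ρ = refl
≢⇒⁻¹≡ {1ℙ} {1ℙ} π≢ρ = contradiction refl π≢ρ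

isOdd : Parity → Bool
isOdd 0ℙ = false
isOdd 1ℙ = true

isOdd-injective : ∀ {π ρ} → isOdd π ≡ isOdd ρ → π ≡ ρ
isOdd-injective {0ℙ} {0ℙ} _ = refl
isOdd-injective {1ℙ} {1ℙ} _ = refl

signOf : Parity → ℚ
signOf 0ℙ = 1ℚ
signOf 1ℙ = - 1ℚ

sign : ℕ → ℚ
sign t = signOf (parity t)

sign-suc : ∀ t → sign (suc t) ≡ - sign t
sign-suc zero          = refl
sign-suc (suc zero)    = refl
sign-suc (suc (suc t)) = sign-suc t

∣sign*p∣≡∣p∣ : ∀ t p → ∣ sign t * p ∣ ≡ ∣ p ∣
∣sign*p∣≡∣p∣ t p =
  trans (ℚP.∣p*q∣≡∣p∣*∣q∣ (sign t) p) (trans (cong (_* ∣ p ∣) (∣sign∣≡1 t)) (ℚP.*-identityˡ ∣ p ∣))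
  where
  ∣sign∣≡1 : ∀ t → ∣ sign t ∣ ≡ 1ℚ
  ∣sign∣≡1 t with parity t
  ... | 0ℙ = refl
  ... | 1ℙ = refl

record Least (P : ℕ → Set) : Set where
  field
    value   : ℕ
    holds   : P value
    minimal : ∀ {s} → P s → value ℕ.≤ s

least : {P : ℕ → Set} → (∀ t → Dec (P t)) → ∀ N → P N → Least P
least {P} P? = <-rec (λ N → P N → Least P) search
  where
  search : ∀ N → (∀ {s} → s ℕ.< N → P s → Least P) → P N → Least P
  search N below PN with ℕP.anyUpTo? P? N
  ... | yes (s , s<N , Ps) = below s<N Ps
  ... | no  ¬smaller       = record
    { value = N ; holds = PN ; minimal = λ Ps → ℕP.≮⇒≥ (λ s<N → ¬smaller (_ , s<N , Ps)) }

-- Walks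

module Walks {m n : ℕ} (e : Edges m n) where

  p q : Fin m → Fin n
  p i = proj₁ (e i)
  q i = proj₂ (e i)

  Joins : Fin m → Fin n → Fin n → Set
  Joins i v w = (p i ≡ v × q i ≡ w) ⊎ (p i ≡ w × q i ≡ v)

  Joins-sym : ∀ {i v w} → Joins i v w → Joins i w v
  Joins-sym (inj₁ pq≡vw) = inj₂ pq≡vw
  Joins-sym (inj₂ pq≡wv) = inj₁ pq≡wv

  infixl 5 _▸_

  data Walk (u : Fin n) : Fin n → ℕ → Set where
    []  : Walk u u 0
    _▸_ : ∀ {v w t} → Walk u v t → Adjacent e v w → Walk u w (suc t)

  _++ᵂ_ : ∀ {u v w s t} → Walk u v s → Walk v w t → Walk u w (t ℕ.+ s)
  w₁ ++ᵂ []       = w₁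
  w₁ ++ᵂ (w₂ ▸ a) = (w₁ ++ᵂ w₂) ▸ a

  reachable⇒walk : ∀ {u v} → Reachable e v u → ∃ (Walk u v)
  reachable⇒walk here                     = 0 , []
  reachable⇒walk (step (i , joins) reach) = _ , proj₂ (reachable⇒walk reach) ▸ (i , Joins-sym joins)

  walk? : ∀ u v t → Dec (Walk u v t)
  walk? u v zero with u ≟ v
  ... | yes refl = yes []
  ... | no  u≢v  = no λ { [] → u≢v refl }
  walk? u v (suc t) with any? (λ i → (q i ≟ v ×-dec walk? u (p i) t) ⊎-dec (p i ≟ v ×-dec walk? u (q i) t))
  ... | yes (i , inj₁ (q≡v , w)) = yes (w ▸ (i , inj₁ (refl , q≡v)))
  ... | yes (i , inj₂ (p≡v , w)) = yes (w ▸ (i , inj₂ (p≡v , refl)))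
  ... | no  none = no λ
    { (w ▸ (i , inj₁ (p≡ , q≡))) → none (i , inj₁ (q≡ , subst (λ x → Walk u x t) (sym p≡) w))
    ; (w ▸ (i , inj₂ (p≡ , q≡))) → none (i , inj₂ (p≡ , subst (λ x → Walk u x t) (sym q≡) w)) }

  joins⇒incident : ∀ {i v w} → Joins i v w → incident e i w ≡ true
  joins⇒incident {i} {w = w} joins with p i ≟ w | q i ≟ w
  ... | yes _   | _       = refl
  ... | no  _   | yes _   = refl
  ... | no  p≢w | no  q≢w = contradiction joins λ { (inj₁ (_ , q≡w)) → q≢w q≡w ; (inj₂ (p≡w , _)) → p≢w p≡w }

  walk⇒incident : ∀ {u v t} → Walk u v (suc t) → ∃ λ i → incident e i v ≡ true
  walk⇒incident (_ ▸ (i , joins)) = i , joins⇒incident joins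

  incMatrix≡δ+δ : Loopless e → ∀ i j → incMatrix e i j ≡ δ (p i) j + δ (q i) j
  incMatrix≡δ+δ loopless i j with p i ≟ j | q i ≟ j
  ... | yes p≡j | yes q≡j = contradiction (trans p≡j (sym q≡j)) (loopless i)
  ... | yes _   | no  _   = refl
  ... | no  _   | yes _   = refl
  ... | no  _   | no  _   = refl

  joins⇒incMatrix : Loopless e → ∀ {i v w} → Joins i v w → ∀ j → incMatrix e i j ≡ δ v j + δ w j
  joins⇒incMatrix loopless {i} (inj₁ (refl , refl)) j = incMatrix≡δ+δ loopless i j
  joins⇒incMatrix loopless {i} (inj₂ (refl , refl)) j =
    trans (incMatrix≡δ+δ loopless i j) (ℚP.+-comm (δ (p i) j) (δ (q i) j))

  module _ (y : Fin n → ℚ) (E : ℚ) (edge≤E : ∀ i → ∣ y (p i) + y (q i) ∣ ≤ E) where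

    joins≤E : ∀ {i v w} → Joins i v w → ∣ y v + y w ∣ ≤ E
    joins≤E {i} (inj₁ (refl , refl)) = edge≤E i
    joins≤E {i} (inj₂ (refl , refl)) = subst (λ z → ∣ z ∣ ≤ E) (ℚP.+-comm (y (p i)) (y (q i))) (edge≤E i)

    walk≤length*E : ∀ {u v t} → Walk u v t → ∣ y u - sign t * y v ∣ ≤ fromℕ t * E
    walk≤length*E {u} [] = ℚP.≤-reflexive (begin-equality
      ∣ y u - 1ℚ * y u ∣  ≡⟨ cong ∣_∣ (solve 1 (λ a → a :- con 1ℚ :* a := con 0ℚ) refl (y u)) ⟩
      0ℚ                  ≡⟨ sym (ℚP.*-zeroˡ E) ⟩
      0ℚ * E              ∎)
      where open ℚP.≤-Reasoning
    walk≤length*E {u} (_▸_ {v} {w} {t} walk (i , joins)) = begin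
      ∣ y u - sign (suc t) * y w ∣
        ≡⟨ cong ∣_∣ split ⟩
      ∣ (y u - sign t * y v) + sign t * (y v + y w) ∣
        ≤⟨ ℚP.∣p+q∣≤∣p∣+∣q∣ (y u - sign t * y v) (sign t * (y v + y w)) ⟩
      ∣ y u - sign t * y v ∣ + ∣ sign t * (y v + y w) ∣
        ≡⟨ cong (∣ y u - sign t * y v ∣ +_) (∣sign*p∣≡∣p∣ t (y v + y w)) ⟩
      ∣ y u - sign t * y v ∣ + ∣ y v + y w ∣
        ≤⟨ ℚP.+-mono-≤ (walk≤length*E walk) (joins≤E joins) ⟩
      fromℕ t * E + E
        ≡⟨ solve 2 (λ l E → l :* E :+ E := (l :+ con 1ℚ) :* E) refl (fromℕ t) E ⟩
      fromℕ (suc t) * E ∎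
      where
      open ℚP.≤-Reasoning
      split : y u - sign (suc t) * y w ≡ (y u - sign t * y v) + sign t * (y v + y w)
      split = trans (cong (λ s → y u - s * y w) (sign-suc t))
        (solve 4 (λ a s b c → a :- (:- s) :* c := (a :- s :* b) :+ s :* (b :+ c)) refl (y u) (sign t) (y v) (y w))

  signedEdges : ∀ {u v t} → Walk u v t → Fin m → ℚ
  signedEdges []                         l = 0ℚ
  signedEdges (_▸_ {t = t} walk (i , _)) l = signedEdges walk l + sign t * δ i l

  -- The alternating signs make the sum telescope.
  signedEdges-incMatrix : Loopless e → ∀ {u v t} (walk : Walk u v t) j →
    sum (λ l → signedEdges walk l * incMatrix e l j) ≡ δ u j - sign t * δ v j
  signedEdges-incMatrix loopless {u} [] j = begin
    sum (λ l → 0ℚ * incMatrix e l j)  ≡⟨ sum-0* (λ l → incMatrix e l j) ⟩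
    0ℚ                                ≡⟨ solve 1 (λ d → con 0ℚ := d :- con 1ℚ :* d) refl (δ u j) ⟩
    δ u j - 1ℚ * δ u j                ∎
    where open ≡-Reasoning
  signedEdges-incMatrix loopless {u} (_▸_ {v} {w} {t} walk (i , joins)) j = begin
    sum (λ l → (g l + s * δ i l) * B l j)
      ≡⟨ sum-cong-≗ (λ l → solve 4 (λ g s d b → (g :+ s :* d) :* b := g :* b :+ s :* (d :* b)) refl (g l) s (δ i l) (B l j)) ⟩
    sum (λ l → g l * B l j + s * (δ i l * B l j))
      ≡⟨ ∑-distrib-+ (λ l → g l * B l j) (λ l → s * (δ i l * B l j)) ⟩
    sum (λ l → g l * B l j) + sum (λ l → s * (δ i l * B l j))
      ≡⟨ cong₂ _+_ (signedEdges-incMatrix loopless walk j) (sym (*-distribˡ-sum s (λ l → δ i l * B l j))) ⟩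
    (δ u j - s * δ v j) + s * sum (λ l → δ i l * B l j)
      ≡⟨ cong (λ x → (δ u j - s * δ v j) + s * x) (trans (sum-δ i (λ l → B l j)) (joins⇒incMatrix loopless joins j)) ⟩
    (δ u j - s * δ v j) + s * (δ v j + δ w j)
      ≡⟨ solve 4 (λ a s b c → (a :- s :* b) :+ s :* (b :+ c) := a :- (:- s) :* c) refl (δ u j) s (δ v j) (δ w j) ⟩
    δ u j - (- s) * δ w j
      ≡⟨ cong (λ x → δ u j - x * δ w j) (sym (sign-suc t)) ⟩
    δ u j - sign (suc t) * δ w j ∎
    where
    open ≡-Reasoning
    g = signedEdges walk
    s = sign t
    B = incMatrix e

  sum∣signedEdges∣≤length : ∀ {u v t} (walk : Walk u v t) → sum (λ l → ∣ signedEdges walk l ∣) ≤ fromℕ t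
  sum∣signedEdges∣≤length [] = ℚP.≤-reflexive (sum-0* (λ (_ : Fin m) → 1ℚ))
  sum∣signedEdges∣≤length (_▸_ {t = t} walk (i , _)) = begin
    sum (λ l → ∣ g l + sign t * δ i l ∣)
      ≤⟨ sum-mono-≤ (λ l → ℚP.∣p+q∣≤∣p∣+∣q∣ (g l) (sign t * δ i l)) ⟩
    sum (λ l → ∣ g l ∣ + ∣ sign t * δ i l ∣)
      ≡⟨ ∑-distrib-+ (λ l → ∣ g l ∣) (λ l → ∣ sign t * δ i l ∣) ⟩
    sum (λ l → ∣ g l ∣) + sum (λ l → ∣ sign t * δ i l ∣)
      ≤⟨ ℚP.+-mono-≤ (sum∣signedEdges∣≤length walk) (ℚP.≤-reflexive one) ⟩
    fromℕ t + 1ℚ ∎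
    where
    open ℚP.≤-Reasoning
    g = signedEdges walk
    one : sum (λ l → ∣ sign t * δ i l ∣) ≡ 1ℚ
    one = trans (sum-cong-≗ (λ l → trans (∣sign*p∣≡∣p∣ t (δ i l)) (sym (δ*1≡∣δ∣ i l)))) (sum-δ i (λ _ → 1ℚ))

  ParityWalk : Fin n → Fin n → Parity → ℕ → Set
  ParityWalk u v π t = Walk u v t × parity t ≡ π

  parityWalk? : ∀ u v π t → Dec (ParityWalk u v π t)
  parityWalk? u v π t = walk? u v t ×-dec (parity t ℙP.≟ π)

  module Parities (connected : Connected e) (nonBipartite : ¬ Bipartite e) where

    walk : ∀ u v → ∃ (Walk u v)
    walk u v = reachable⇒walk (connected v u)

    monochromaticEdge : ∀ k → ∃ λ i → parity (proj₁ (walk k (p i))) ≡ parity (proj₁ (walk k (q i)))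
    monochromaticEdge k with any? (λ i → parity (proj₁ (walk k (p i))) ℙP.≟ parity (proj₁ (walk k (q i))))
    ... | yes found = found
    ... | no  none  = contradiction (colour , λ i same → none (i , isOdd-injective same)) nonBipartite
      where
      colour : Fin n → Bool
      colour v = isOdd (parity (proj₁ (walk k v)))

    -- The monochromatic edge gives walks of both parities from u to q i; continue both to v.
    parityWalk : ∀ u v π → ∃ (ParityWalk u v π)
    parityWalk u v π with monochromaticEdge u
    ... | i , same with walk u (p i) | walk u (q i) | walk (q i) v
    ...   | a , u→p | b , u→q | c , q→v with parity (c ℕ.+ b) ℙP.≟ π
    ...     | yes c+b≡π = c ℕ.+ b , u→q ++ᵂ q→v , c+b≡π
    ...     | no  c+b≢π = c ℕ.+ suc a , (u→p ▸ (i , inj₁ (refl , refl))) ++ᵂ q→v , trans opposite (≢⇒⁻¹≡ c+b≢π)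
      where
      opposite : parity (c ℕ.+ suc a) ≡ parity (c ℕ.+ b) ⁻¹
      opposite = begin
        parity (c ℕ.+ suc a)         ≡⟨ ℙP.+-homo-+ c (suc a) ⟩
        parity c ℙ.+ parity (suc a)  ≡⟨ cong (parity c ℙ.+_) (trans (parity-suc a) (cong _⁻¹ same)) ⟩
        parity c ℙ.+ parity b ⁻¹     ≡⟨ +⁻¹≡⁻¹ (parity c) (parity b) ⟩
        (parity c ℙ.+ parity b) ⁻¹   ≡⟨ cong _⁻¹ (sym (ℙP.+-homo-+ c b)) ⟩
        parity (c ℕ.+ b) ⁻¹          ∎
        where open ≡-Reasoning

    -- Opaque: otherwise type checking may evaluate the search for shortest walks.
    opaque
      distance : ∀ u v π → Least (ParityWalk u v π)
      distance u v π = least (parityWalk? u v π) _ (proj₂ (parityWalk u v π))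

nonBipartite⇒vertex : ∀ {m n} (e : Edges m n) → ¬ Bipartite e → Fin n
nonBipartite⇒vertex {n = zero}  e nonBipartite =
  contradiction ((λ ()) , λ i → contradiction (proj₁ (e i)) ¬Fin0) nonBipartite
nonBipartite⇒vertex {n = suc _} e nonBipartite = zero

-- Extremal vectors and generalized inverses of W

module Extremal {m n : ℕ} (e : Edges m n)
  (loopless : Loopless e) (connected : Connected e) (nonBipartite : ¬ Bipartite e) where

  open Walks e
  open Parities connected nonBipartite

  oddGirth : Fin n → ℕ
  oddGirth k = Least.value (distance k k 1ℙ)

  shortestOddWalk : ∀ k → Walk k k (oddGirth k)
  shortestOddWalk k = proj₁ (Least.holds (distance k k 1ℙ))

  oddGirth-odd : ∀ k → parity (oddGirth k) ≡ 1ℙ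
  oddGirth-odd k = proj₂ (Least.holds (distance k k 1ℙ))

  degree≡suc : ∀ k → ∃ λ c → degree e k ≡ suc c
  degree≡suc k =
    let i , k∈i = walk⇒incident (subst (Walk k k) (proj₂ (odd⇒suc (oddGirth k) (oddGirth-odd k))) (shortestOddWalk k))
    in  count≡suc (λ i → incident e i k) i k∈i

  d d⁻¹ : Fin n → ℚ
  d   k = inv⁻¹ (degree e k)
  d⁻¹ k = inv (degree e k)

  d*d⁻¹≡1 : ∀ k → d k * d⁻¹ k ≡ 1ℚ
  d*d⁻¹≡1 k = inv⁻¹*inv≡1 (proj₂ (degree≡suc k))

  0<d/2 : ∀ k → 0ℚ < d k * ½
  0<d/2 k = 0<p*q (0<inv⁻¹ (proj₂ (degree≡suc k))) (ℚP.positive⁻¹ ½)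

  0≤d/2 : ∀ k → 0ℚ ≤ d k * ½
  0≤d/2 k = ℚP.<⇒≤ (0<d/2 k)

  κ-at : Fin n → ℚ
  κ-at k = d k * ½ * fromℕ (oddGirth k)

  0<κ-at : ∀ k → 0ℚ < κ-at k
  0<κ-at k with odd⇒suc (oddGirth k) (oddGirth-odd k)
  ... | t , L≡1+t = 0<p*q (0<d/2 k) (subst (λ s → 0ℚ < fromℕ s) (sym L≡1+t) (0<fromℕ-suc t))

  scaled : (Fin n → ℚ) → Fin n → ℚ
  scaled X v = X v * d⁻¹ v

  W·v≡ : ∀ X i → (W e ·v X) i ≡ scaled X (p i) + scaled X (q i)
  W·v≡ X i = begin
    (W e ·v X) i
      ≡⟨ ·v≡sum (W e) X i ⟩
    sum (λ l → incMatrix e i l * d⁻¹ l * X l)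
      ≡⟨ sum-cong-≗ (λ l → cong (λ b → b * d⁻¹ l * X l) (incMatrix≡δ+δ loopless i l)) ⟩
    sum (λ l → (δ (p i) l + δ (q i) l) * d⁻¹ l * X l)
      ≡⟨ sum-cong-≗ (λ l → distrib (δ (p i) l) (δ (q i) l) l) ⟩
    sum (λ l → δ (p i) l * scaled X l + δ (q i) l * scaled X l)
      ≡⟨ ∑-distrib-+ (λ l → δ (p i) l * scaled X l) (λ l → δ (q i) l * scaled X l) ⟩
    sum (λ l → δ (p i) l * scaled X l) + sum (λ l → δ (q i) l * scaled X l)
      ≡⟨ cong₂ _+_ (sum-δ (p i) (scaled X)) (sum-δ (q i) (scaled X)) ⟩
    scaled X (p i) + scaled X (q i) ∎
    where
    open ≡-Reasoning
    distrib : ∀ a b l → (a + b) * d⁻¹ l * X l ≡ a * scaled X l + b * scaled X l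
    distrib a b l = solve 4 (λ a b c x → (a :+ b) :* c :* x := a :* (x :* c) :+ b :* (x :* c)) refl a b (d⁻¹ l) (X l)

  ‖W·v‖∞≡edgeObjective : ∀ X → ‖ W e ·v X ‖∞ ≡ edgeObjective e X
  ‖W·v‖∞≡edgeObjective X = maxF-cong (λ i → cong ∣_∣ (W·v≡ X i))

  0≤edgeObjective : ∀ X → 0ℚ ≤ edgeObjective e X
  0≤edgeObjective X = 0≤maxF (λ i → ∣ scaled X (p i) + scaled X (q i) ∣)

  ∣X∣≤κ-at*edgeObjective : ∀ X k → ∣ X k ∣ ≤ κ-at k * edgeObjective e X
  ∣X∣≤κ-at*edgeObjective X k = begin
    ∣ X k ∣                             ≡⟨ cong ∣_∣ Xk≡ ⟩
    ∣ d k * ½ * (y k - sign L * y k) ∣  ≡⟨ ∣p*q∣≡p*∣q∣ (y k - sign L * y k) (0≤d/2 k) ⟩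
    d k * ½ * ∣ y k - sign L * y k ∣    ≤⟨ *-monoˡ-≤-0≤ (0≤d/2 k) (walk≤length*E y E edge≤E (shortestOddWalk k)) ⟩
    d k * ½ * (fromℕ L * E)             ≡⟨ sym (ℚP.*-assoc (d k * ½) (fromℕ L) E) ⟩
    κ-at k * E                          ∎
    where
    open ℚP.≤-Reasoning
    y = scaled X
    E = edgeObjective e X
    L = oddGirth k
    edge≤E : ∀ i → ∣ y (p i) + y (q i) ∣ ≤ E
    edge≤E = ≤-maxF (λ i → ∣ y (p i) + y (q i) ∣)
    Xk≡ : X k ≡ d k * ½ * (y k - sign L * y k)
    Xk≡ = begin-equality
      X k                             ≡⟨ sym (ℚP.*-identityˡ (X k)) ⟩
      1ℚ * X k                        ≡⟨ cong (_* X k) (sym (d*d⁻¹≡1 k)) ⟩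
      d k * d⁻¹ k * X k               ≡⟨ solve 3 (λ a b x → a :* b :* x := a :* con ½ :* (x :* b :- con (- 1ℚ) :* (x :* b)))
                                           refl (d k) (d⁻¹ k) (X k) ⟩
      d k * ½ * (y k - - 1ℚ * y k)    ≡⟨ cong (λ s → d k * ½ * (y k - s * y k)) (sym (cong signOf (oddGirth-odd k))) ⟩
      d k * ½ * (y k - sign L * y k)  ∎

  k* : Fin n
  k* = proj₁ (argmax (nonBipartite⇒vertex e nonBipartite) κ-at)

  κ : ℚ
  κ = κ-at k*

  κ-at≤κ : ∀ k → κ-at k ≤ κ
  κ-at≤κ = proj₂ (argmax (nonBipartite⇒vertex e nonBipartite) κ-at)

  0≤κ : 0ℚ ≤ κ
  0≤κ = ℚP.<⇒≤ (0<κ-at k*)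

  instance
    κ≢0 : ℚ.NonZero κ
    κ≢0 = ℚP.pos⇒nonZero κ {{ℚ.positive (0<κ-at k*)}}

  μ : ℚ
  μ = ℚ.1/ κ

  0≤μ : 0ℚ ≤ μ
  0≤μ = ℚP.<⇒≤ (ℚP.positive⁻¹ μ {{ℚP.1/pos⇒pos κ {{ℚ.positive (0<κ-at k*)}}}})

  ‖X‖∞≤κ*edgeObjective : ∀ X → ‖ X ‖∞ ≤ κ * edgeObjective e X
  ‖X‖∞≤κ*edgeObjective X = maxF-lub (λ k → ∣ X k ∣) (0≤p*q 0≤κ (0≤edgeObjective X)) λ k →
    ℚP.≤-trans (∣X∣≤κ-at*edgeObjective X k) (*-monoʳ-≤-0≤ (0≤edgeObjective X) (κ-at≤κ k))

  μ≤edgeObjective : ∀ X → ‖ X ‖∞ ≡ 1ℚ → μ ≤ edgeObjective e X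
  μ≤edgeObjective X ‖X‖∞≡1 = begin
    μ            ≡⟨ sym (ℚP.*-identityʳ μ) ⟩
    μ * 1ℚ       ≤⟨ *-monoˡ-≤-0≤ 0≤μ (subst (_≤ κ * E) ‖X‖∞≡1 (‖X‖∞≤κ*edgeObjective X)) ⟩
    μ * (κ * E)  ≡⟨ sym (ℚP.*-assoc μ κ E) ⟩
    μ * κ * E    ≡⟨ cong (_* E) (ℚP.*-inverseˡ κ) ⟩
    1ℚ * E       ≡⟨ ℚP.*-identityˡ E ⟩
    E            ∎
    where
    open ℚP.≤-Reasoning
    E = edgeObjective e X

  W-injective : Injective (W e)
  W-injective X Y WX≡WY k =
    x∙y⁻¹≈ε⇒x≈y (X k) (Y k) (ℚP.∣p∣≡0⇒p≡0 (Z k) (ℚP.≤-antisym ∣Zk∣≤0 (ℚP.0≤∣p∣ (Z k))))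
    where
    Z : Fin n → ℚ
    Z v = X v - Y v
    edge≡0 : ∀ i → scaled Z (p i) + scaled Z (q i) ≡ 0ℚ
    edge≡0 i = begin
      scaled Z (p i) + scaled Z (q i)
        ≡⟨ solve 6 (λ xp xq yp yq dp dq → (xp :- yp) :* dp :+ (xq :- yq) :* dq := (xp :* dp :+ xq :* dq) :- (yp :* dp :+ yq :* dq))
             refl (X (p i)) (X (q i)) (Y (p i)) (Y (q i)) (d⁻¹ (p i)) (d⁻¹ (q i)) ⟩
      (scaled X (p i) + scaled X (q i)) - (scaled Y (p i) + scaled Y (q i))
        ≡⟨ cong₂ _-_ (sym (W·v≡ X i)) (sym (W·v≡ Y i)) ⟩
      (W e ·v X) i - (W e ·v Y) i
        ≡⟨ cong (_- (W e ·v Y) i) (WX≡WY i) ⟩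
      (W e ·v Y) i - (W e ·v Y) i
        ≡⟨ ℚP.+-inverseʳ ((W e ·v Y) i) ⟩
      0ℚ ∎
      where open ≡-Reasoning
    edgeObjective≤0 : edgeObjective e Z ≤ 0ℚ
    edgeObjective≤0 = maxF-lub (λ i → ∣ scaled Z (p i) + scaled Z (q i) ∣) ℚP.≤-refl
      (λ i → ℚP.≤-reflexive (cong ∣_∣ (edge≡0 i)))
    ∣Zk∣≤0 : ∣ Z k ∣ ≤ 0ℚ
    ∣Zk∣≤0 = ℚP.≤-trans (∣X∣≤κ-at*edgeObjective Z k)
      (subst (κ-at k * edgeObjective e Z ≤_) (ℚP.*-zeroʳ (κ-at k))
        (*-monoˡ-≤-0≤ (ℚP.<⇒≤ (0<κ-at k)) edgeObjective≤0))

  evenDist oddDist : Fin n → ℕ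
  evenDist v = Least.value (distance k* v 0ℙ)
  oddDist  v = Least.value (distance k* v 1ℙ)

  distance-joins : ∀ π {i v w} → Joins i v w →
    Least.value (distance k* w (π ⁻¹)) ℕ.≤ suc (Least.value (distance k* v π))
  distance-joins π {i} {v} {w} joins with Least.holds (distance k* v π)
  ... | shortest , parity≡π = Least.minimal (distance k* w (π ⁻¹))
    (shortest ▸ (i , joins) , trans (parity-suc (Least.value (distance k* v π))) (cong _⁻¹ parity≡π))

  gap : Fin n → ℚ
  gap v = fromℕ (oddDist v) - fromℕ (evenDist v)

  ∣gap+gap∣≤2 : ∀ i → ∣ gap (p i) + gap (q i) ∣ ≤ 1ℚ + 1ℚ
  ∣gap+gap∣≤2 i = begin
    ∣ gap (p i) + gap (q i) ∣
      ≡⟨ cong ∣_∣ (solve 4 (λ ap aq bp bq → (bp :- ap) :+ (bq :- aq) := (bp :- aq) :+ (bq :- ap)) refl ap aq bp bq) ⟩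
    ∣ (bp - aq) + (bq - ap) ∣
      ≤⟨ ℚP.∣p+q∣≤∣p∣+∣q∣ (bp - aq) (bq - ap) ⟩
    ∣ bp - aq ∣ + ∣ bq - ap ∣
      ≤⟨ ℚP.+-mono-≤ (∣p-q∣≤1 (across 0ℙ q→p) (across 1ℙ p→q))
                     (∣p-q∣≤1 (across 0ℙ p→q) (across 1ℙ q→p)) ⟩
    1ℚ + 1ℚ ∎
    where
    open ℚP.≤-Reasoning
    ap = fromℕ (evenDist (p i))
    aq = fromℕ (evenDist (q i))
    bp = fromℕ (oddDist (p i))
    bq = fromℕ (oddDist (q i))
    p→q : Joins i (p i) (q i)
    p→q = inj₁ (refl , refl)
    q→p : Joins i (q i) (p i)
    q→p = inj₂ (refl , refl)
    across : ∀ π {v w} → Joins i v w →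
      fromℕ (Least.value (distance k* w (π ⁻¹))) ≤ fromℕ (Least.value (distance k* v π)) + 1ℚ
    across π joins = fromℕ-mono-≤ (distance-joins π joins)

  X* : Fin n → ℚ
  X* v = d v * ½ * gap v * μ

  edgeObjective-X*≤μ : edgeObjective e X* ≤ μ
  edgeObjective-X*≤μ = maxF-lub (λ i → ∣ scaled X* (p i) + scaled X* (q i) ∣) 0≤μ λ i → begin
    ∣ scaled X* (p i) + scaled X* (q i) ∣
      ≡⟨ cong ∣_∣ (trans (cong₂ _+_ (scaled-X* (p i)) (scaled-X* (q i)))
                         (sym (ℚP.*-distribˡ-+ (½ * μ) (gap (p i)) (gap (q i))))) ⟩
    ∣ ½ * μ * (gap (p i) + gap (q i)) ∣
      ≡⟨ ∣p*q∣≡p*∣q∣ (gap (p i) + gap (q i)) 0≤μ/2 ⟩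
    ½ * μ * ∣ gap (p i) + gap (q i) ∣
      ≤⟨ *-monoˡ-≤-0≤ 0≤μ/2 (∣gap+gap∣≤2 i) ⟩
    ½ * μ * (1ℚ + 1ℚ)
      ≡⟨ solve 1 (λ u → con ½ :* u :* (con 1ℚ :+ con 1ℚ) := u) refl μ ⟩
    μ ∎
    where
    open ℚP.≤-Reasoning
    0≤μ/2 : 0ℚ ≤ ½ * μ
    0≤μ/2 = 0≤p*q (ℚP.<⇒≤ (ℚP.positive⁻¹ ½)) 0≤μ
    scaled-X* : ∀ v → scaled X* v ≡ ½ * μ * gap v
    scaled-X* v = begin-equality
      d v * ½ * gap v * μ * d⁻¹ v    ≡⟨ solve 4 (λ a b x u → a :* con ½ :* x :* u :* b := a :* b :* (con ½ :* u :* x))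
                                          refl (d v) (d⁻¹ v) (gap v) μ ⟩
      d v * d⁻¹ v * (½ * μ * gap v)  ≡⟨ cong (_* (½ * μ * gap v)) (d*d⁻¹≡1 v) ⟩
      1ℚ * (½ * μ * gap v)           ≡⟨ ℚP.*-identityˡ (½ * μ * gap v) ⟩
      ½ * μ * gap v                  ∎

  X*-k*≡1 : X* k* ≡ 1ℚ
  X*-k*≡1 = begin
    d k* * ½ * (fromℕ (oddGirth k*) - fromℕ (evenDist k*)) * μ
      ≡⟨ cong (λ t → d k* * ½ * (fromℕ (oddGirth k*) - fromℕ t) * μ) evenDist-k*≡0 ⟩
    d k* * ½ * (fromℕ (oddGirth k*) - 0ℚ) * μ
      ≡⟨ cong (λ x → d k* * ½ * x * μ) (ℚP.+-identityʳ (fromℕ (oddGirth k*))) ⟩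
    κ * μ
      ≡⟨ ℚP.*-inverseʳ κ ⟩
    1ℚ ∎
    where
    open ≡-Reasoning
    evenDist-k*≡0 : evenDist k* ≡ 0
    evenDist-k*≡0 = ℕP.n≤0⇒n≡0 (Least.minimal (distance k* k* 0ℙ) ([] , refl))

  ‖X*‖∞≡1 : ‖ X* ‖∞ ≡ 1ℚ
  ‖X*‖∞≡1 = maxF-attained (λ v → ∣ X* v ∣) k* (ℚP.<⇒≤ (ℚP.positive⁻¹ 1ℚ)) ∣X*∣≤1 (cong ∣_∣ X*-k*≡1)
    where
    ∣X*∣≤1 : ∀ v → ∣ X* v ∣ ≤ 1ℚ
    ∣X*∣≤1 v = begin
      ∣ X* v ∣                     ≤⟨ ∣X∣≤κ-at*edgeObjective X* v ⟩
      κ-at v * edgeObjective e X*  ≤⟨ *-monoʳ-≤-0≤ (0≤edgeObjective X*) (κ-at≤κ v) ⟩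
      κ * edgeObjective e X*       ≤⟨ *-monoˡ-≤-0≤ 0≤κ edgeObjective-X*≤μ ⟩
      κ * μ                        ≡⟨ ℚP.*-inverseʳ κ ⟩
      1ℚ                           ∎
      where open ℚP.≤-Reasoning

  edgeObjective-X*≡μ : edgeObjective e X* ≡ μ
  edgeObjective-X*≡μ = ℚP.≤-antisym edgeObjective-X*≤μ (μ≤edgeObjective X* ‖X*‖∞≡1)

  G* : Matrix n m
  G* k l = d k * ½ * signedEdges (shortestOddWalk k) l

  G*·W≡δ : ∀ k j → (G* · W e) k j ≡ δ k j
  G*·W≡δ k j = begin
    (G* ·v (λ l → W e l j)) k
      ≡⟨ ·v≡sum G* (λ l → W e l j) k ⟩
    sum (λ l → d k * ½ * g l * (B l j * d⁻¹ j))
      ≡⟨ sum-cong-≗ (λ l → solve 5 (λ a h x b c → a :* h :* x :* (b :* c) := a :* h :* c :* (x :* b))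
                                    refl (d k) ½ (g l) (B l j) (d⁻¹ j)) ⟩
    sum (λ l → c * (g l * B l j))
      ≡⟨ sym (*-distribˡ-sum c (λ l → g l * B l j)) ⟩
    c * sum (λ l → g l * B l j)
      ≡⟨ cong (c *_) (signedEdges-incMatrix loopless (shortestOddWalk k) j) ⟩
    c * (δ k j - sign (oddGirth k) * δ k j)
      ≡⟨ cong (λ s → c * (δ k j - s * δ k j)) (cong signOf (oddGirth-odd k)) ⟩
    c * (δ k j - - 1ℚ * δ k j)
      ≡⟨ solve 3 (λ a b x → a :* con ½ :* b :* (x :- con (- 1ℚ) :* x) := a :* b :* x) refl (d k) (d⁻¹ j) (δ k j) ⟩
    d k * d⁻¹ j * δ k j
      ≡⟨ δ-diag (λ x → d k * d⁻¹ x) k j ⟩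
    d k * d⁻¹ k * δ k j
      ≡⟨ cong (_* δ k j) (d*d⁻¹≡1 k) ⟩
    1ℚ * δ k j
      ≡⟨ ℚP.*-identityˡ (δ k j) ⟩
    δ k j ∎
    where
    open ≡-Reasoning
    g = signedEdges (shortestOddWalk k)
    B = incMatrix e
    c = d k * ½ * d⁻¹ j

  G*-genInverse : GenInverse (W e) G*
  G*-genInverse = leftInverse⇒genInverse (W e) G* G*·W≡δ

  ‖G*‖∞∞≤κ : ‖ G* ‖∞∞ ≤ κ
  ‖G*‖∞∞≤κ = maxF-lub (λ k → sumF (λ l → ∣ G* k l ∣)) 0≤κ λ k → begin
    sumF (λ l → ∣ G* k l ∣)          ≡⟨ sumF≡sum (λ l → ∣ G* k l ∣) ⟩
    sum (λ l → ∣ d k * ½ * g k l ∣)  ≡⟨ sum-cong-≗ (λ l → ∣p*q∣≡p*∣q∣ (g k l) (0≤d/2 k)) ⟩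
    sum (λ l → d k * ½ * ∣ g k l ∣)  ≡⟨ sym (*-distribˡ-sum (d k * ½) (λ l → ∣ g k l ∣)) ⟩
    d k * ½ * sum (λ l → ∣ g k l ∣)  ≤⟨ *-monoˡ-≤-0≤ (0≤d/2 k) (sum∣signedEdges∣≤length (shortestOddWalk k)) ⟩
    κ-at k                           ≤⟨ κ-at≤κ k ⟩
    κ                                ∎
    where
    open ℚP.≤-Reasoning
    g : Fin n → Fin m → ℚ
    g k = signedEdges (shortestOddWalk k)

  κ≤‖G‖∞∞ : ∀ G → GenInverse (W e) G → κ ≤ ‖ G ‖∞∞
  κ≤‖G‖∞∞ G WGW≡W = begin
    κ                  ≡⟨ sym (ℚP.*-identityʳ κ) ⟩
    κ * 1ℚ             ≤⟨ *-monoˡ-≤-0≤ 0≤κ 1≤‖G‖μ ⟩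
    κ * (‖ G ‖∞∞ * μ)  ≡⟨ solve 3 (λ k g u → k :* (g :* u) := g :* (k :* u)) refl κ ‖ G ‖∞∞ μ ⟩
    ‖ G ‖∞∞ * (κ * μ)  ≡⟨ cong (‖ G ‖∞∞ *_) (ℚP.*-inverseʳ κ) ⟩
    ‖ G ‖∞∞ * 1ℚ       ≡⟨ ℚP.*-identityʳ ‖ G ‖∞∞ ⟩
    ‖ G ‖∞∞            ∎
    where
    open ℚP.≤-Reasoning
    1≤‖G‖μ : 1ℚ ≤ ‖ G ‖∞∞ * μ
    1≤‖G‖μ = subst₂ (λ x y → x ≤ ‖ G ‖∞∞ * y)
      ‖X*‖∞≡1 (trans (‖W·v‖∞≡edgeObjective X*) edgeObjective-X*≡μ)
      (‖x‖∞≤‖G‖∞∞*‖Ax‖∞ (W e) G WGW≡W W-injective X*)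

  edgeObjective-minimum : IsMinimum (λ (X : Fin n → ℚ) → ‖ X ‖∞ ≡ 1ℚ) (edgeObjective e) μ
  edgeObjective-minimum = (X* , ‖X*‖∞≡1 , edgeObjective-X*≡μ) , μ≤edgeObjective

  ‖G‖∞∞-minimum : IsMinimum (GenInverse (W e)) ‖_‖∞∞ κ
  ‖G‖∞∞-minimum =
    (G* , G*-genInverse , ℚP.≤-antisym ‖G*‖∞∞≤κ (κ≤‖G‖∞∞ G* G*-genInverse)) , κ≤‖G‖∞∞

theorem3p1 : (m n : ℕ) (e : Edges m n) → Simple e → Connected e → ¬ Bipartite e → m ≥ n →
    Σ ℚ λ μ → Σ ℚ λ κ →
      IsMinimum (λ (X : Fin n → ℚ) → ‖ X ‖∞ ≡ 1ℚ) (edgeObjective e) μ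
      × IsMinimum (λ (X : Fin n → ℚ) → ‖ X ‖∞ ≡ 1ℚ) (λ X → ‖ W e ·v X ‖∞) μ
      × IsMinimum (GenInverse (W e)) ‖_‖∞∞ κ
      × μ * κ ≡ 1ℚ
theorem3p1 m n e (loopless , _) connected nonBipartite _ =
  μ , κ ,
  edgeObjective-minimum ,
  IsMinimum-cong (λ X → sym (‖W·v‖∞≡edgeObjective X)) edgeObjective-minimum ,
  ‖G‖∞∞-minimum ,
  ℚP.*-inverseˡ κ
  where open Extremal e loopless connected nonBipartite
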